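{- Let $n,\delta,\ell$ be positive integers. Given a multiset $S$ whose elements are from the universe $U=\{1,2,\dots,n\}$ and in which every element has multiplicity at most $\ell$, any data structure that supports ${\textsf{drankA}}$ queries on $S$ with additive error $\delta$ requires at least $\lfloor n/\lceil\delta/\ell\rceil\rfloor\lg(\max(\lfloor\ell/\delta\rfloor,1)+1)$ bits.
   Context: For a multiset $S$ over $\{1,\dots,n\}$, ${\textsf{rank}}(i,S)=|\{j\in S\mid j\le i\}|$ (counted with multiplicity). ${\textsf{drankA}}(i,S,\delta)$ returns any value $r$ with ${\textsf{rank}}(i,S)-\delta<r\le{\textsf{rank}}(i,S)$. The lower bound is over all multisets satisfying the multiplicity bound $\ell$. -}

module Defs where

open import Data.Nat using (ℕ; suc; _+_; _*_; _∸_; _≤_; _≤?_; _/_; NonZero)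
open import Data.Fin using (Fin; toℕ)
open import Data.List using (List; map; filter; allFin)
open import Data.Nat.ListAction using (sum)
open import Data.Integer using (ℤ; +_; _-_; _<_) renaming (_≤_ to _≤ℤ_)
open import Data.Product using (Σ; _×_)

-- A multiset over the universe {1,…,n}, given by its multiplicity function.
-- Element k ∈ {1,…,n} is represented by the index (k-1) : Fin n.
Multiset : ℕ → Set
Multiset n = Fin n → ℕ

Bounded : ∀ {n} → ℕ → Multiset n → Set
Bounded {n} ℓ S = (j : Fin n) → S j ≤ ℓ

BoundedMultiset : ℕ → ℕ → Set
BoundedMultiset n ℓ = Σ (Multiset n) (Bounded ℓ)

rank : ∀ {n} → Fin n → Multiset n → ℕ
rank {n} i S = sum (map S (filter (λ j → toℕ j ≤? toℕ i) (allFin n)))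

ValidDrankA : ℕ → ℕ → ℤ → Set
ValidDrankA rk δ r = ((+ rk) - (+ δ) < r) × (r ≤ℤ + rk)

-- ⌈ a / b ⌉ for a ≥ 1 and b ≥ 1, written as 1 + ⌊(a-1)/b⌋ so that it is
-- syntactically nonzero (needed as a divisor).
ceilDiv : (a b : ℕ) → .{{NonZero b}} → ℕ
ceilDiv a b = suc ((a ∸ 1) / b)

-- Cut the universe into m = ⌊n/k⌋ blocks of k = ⌈δ/ℓ⌉ consecutive elements and give block j
-- exactly c_j·δ copies, where c_j ∈ {0,…,q} and q = max(⌊ℓ/δ⌋,1), packed at most ℓ per element;
-- this fits because q·δ ≤ k·ℓ. The rank at the last element of block j is then δ·(c_0+⋯+c_j), and
-- two multiples of δ admitting a common drankA answer are equal, so the query answers recover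
-- every c_j. Hence the (q+1)^m multisets built this way have pairwise distinct b-bit encodings.

module Submission where

open import Defs
open import Data.Nat
  using (ℕ; NonZero; zero; suc; pred; _+_; _*_; _∸_; _^_; _/_; _%_; _⊔_; _⊓_;
         _≤_; _<_; z≤n; s≤s; z<s; s<s; _≤?_)
open import Data.Nat.Properties
open import Data.Nat.DivMod
open import Data.Nat.ListAction using (sum)
open import Data.Fin using (Fin; zero; suc; toℕ; fromℕ<; finToFun; funToFin; combine)
open import Data.Fin.Properties
  using (toℕ<n; toℕ-injective; toℕ-fromℕ<; funToFin-finToFin; finToFun-funToFin; 2↔Bool; injective⇒≤)
open import Data.Bool using (Bool)
open import Data.Vec as Vec using (Vec; lookup)
open import Data.Vec.Properties using (tabulate∘lookup; tabulate-cong)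
open import Data.List using (List; []; _∷_; map; filter; allFin; tabulate)
open import Data.List.Properties using (map-tabulate)
open import Data.Integer as Int using (ℤ)
import Data.Integer.Properties as Intₚ
open import Data.Product using (proj₁; _,_)
open import Function using (_∘_; Inverse)
open import Function.Definitions using (Injective)
open import Relation.Binary.PropositionalEquality
open import Relation.Nullary using (Dec; yes; no; contradiction)

sumBelow : (ℕ → ℕ) → ℕ → ℕ
sumBelow f zero    = 0
sumBelow f (suc t) = f 0 + sumBelow (f ∘ suc) t

sumBelow-cong : ∀ t {f g : ℕ → ℕ} → (∀ u → u < t → f u ≡ g u) → sumBelow f t ≡ sumBelow g t
sumBelow-cong zero    eq = refl
sumBelow-cong (suc t) eq =
  cong₂ _+_ (eq 0 z<s) (sumBelow-cong t (λ u u<t → eq (suc u) (s<s u<t)))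

sumBelow-+ : ∀ s t (f : ℕ → ℕ) → sumBelow f (s + t) ≡ sumBelow f s + sumBelow (f ∘ (s +_)) t
sumBelow-+ zero    t f = refl
sumBelow-+ (suc s) t f =
  trans (cong (f 0 +_) (sumBelow-+ s t (f ∘ suc))) (sym (+-assoc (f 0) _ _))

sumBelow-suc : ∀ t (f : ℕ → ℕ) → sumBelow f (suc t) ≡ sumBelow f t + f t
sumBelow-suc zero    f = +-identityʳ (f 0)
sumBelow-suc (suc t) f =
  trans (cong (f 0 +_) (sumBelow-suc t (f ∘ suc))) (sym (+-assoc (f 0) _ _))

sumBelow-*ʳ : ∀ t (f : ℕ → ℕ) c → sumBelow (λ u → f u * c) t ≡ sumBelow f t * c
sumBelow-*ʳ zero    f c = refl
sumBelow-*ʳ (suc t) f c =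
  trans (cong (f 0 * c +_) (sumBelow-*ʳ t (f ∘ suc) c)) (sym (*-distribʳ-+ c (f 0) _))

sumBelow-zero : ∀ t (f : ℕ → ℕ) → (∀ u → f u ≡ 0) → sumBelow f t ≡ 0
sumBelow-zero zero    f f≡0 = refl
sumBelow-zero (suc t) f f≡0 = cong₂ _+_ (f≡0 0) (sumBelow-zero t (f ∘ suc) (f≡0 ∘ suc))

sumBelow-truncate : ∀ {a t} (f g : ℕ → ℕ) → a < t →
  (∀ u → u ≤ a → g u ≡ f u) → (∀ u → a < u → g u ≡ 0) → sumBelow g t ≡ sumBelow f (suc a)
sumBelow-truncate {a} {t} f g a<t g≡f g≡0 = begin
  sumBelow g t                                                ≡⟨ cong (sumBelow g) (m+[n∸m]≡n a<t) ⟨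
  sumBelow g (suc a + (t ∸ suc a))                            ≡⟨ sumBelow-+ (suc a) (t ∸ suc a) g ⟩
  sumBelow g (suc a) + sumBelow (g ∘ (suc a +_)) (t ∸ suc a)  ≡⟨ cong₂ _+_ agree vanish ⟩
  sumBelow f (suc a) + 0                                      ≡⟨ +-identityʳ _ ⟩
  sumBelow f (suc a)                                          ∎
  where
    open ≡-Reasoning
    agree : sumBelow g (suc a) ≡ sumBelow f (suc a)
    agree = sumBelow-cong (suc a) (λ u u<1+a → g≡f u (m<1+n⇒m≤n u<1+a))
    vanish : sumBelow (g ∘ (suc a +_)) (t ∸ suc a) ≡ 0
    vanish = sumBelow-zero (t ∸ suc a) _ (λ u → g≡0 (suc a + u) (s≤s (m≤m+n a u)))

sumBelow-injective : ∀ m {f g : ℕ → ℕ} → (∀ j → j < m → sumBelow f (suc j) ≡ sumBelow g (suc j)) →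
  ∀ j → j < m → f j ≡ g j
sumBelow-injective m {f} {g} same j j<m = +-cancelˡ-≡ (sumBelow f j) _ _ (begin
  sumBelow f j + f j        ≡⟨ sumBelow-suc j f ⟨
  sumBelow f (suc j)        ≡⟨ same j j<m ⟩
  sumBelow g (suc j)        ≡⟨ sumBelow-suc j g ⟩
  sumBelow g j + g j        ≡⟨ cong (_+ g j) (sameBefore j j<m) ⟨
  sumBelow f j + g j        ∎)
  where
    open ≡-Reasoning
    sameBefore : ∀ j → j < m → sumBelow f j ≡ sumBelow g j
    sameBefore zero    _     = refl
    sameBefore (suc j) 1+j<m = same j (<-trans (n<1+n j) 1+j<m)

indicator : ∀ {P : Set} → Dec P → ℕ → ℕ
indicator (yes _) x = x
indicator (no _)  x = 0

sum-map-filter : ∀ {A : Set} {P : A → Set} (P? : ∀ x → Dec (P x)) (f : A → ℕ) (xs : List A) →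
  sum (map f (filter P? xs)) ≡ sum (map (λ x → indicator (P? x) (f x)) xs)
sum-map-filter P? f []       = refl
sum-map-filter P? f (x ∷ xs) with P? x
... | yes _ = cong (f x +_) (sum-map-filter P? f xs)
... | no  _ = sum-map-filter P? f xs

sum-map-allFin : ∀ n (f : ℕ → ℕ) → sum (map (f ∘ toℕ) (allFin n)) ≡ sumBelow f n
sum-map-allFin n f = trans (cong sum (map-tabulate {n = n} (λ i → i) (f ∘ toℕ))) (sum-tabulate n f)
  where
    sum-tabulate : ∀ n (f : ℕ → ℕ) → sum (tabulate {n = n} (f ∘ toℕ)) ≡ sumBelow f n
    sum-tabulate zero    f = refl
    sum-tabulate (suc n) f = cong (f 0 +_) (sum-tabulate n (f ∘ suc))

rank-toℕ : ∀ {n} (f : ℕ → ℕ) (i : Fin n) → rank i (f ∘ toℕ) ≡ sumBelow f (suc (toℕ i))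
rank-toℕ {n} f i = begin
  rank i (f ∘ toℕ)              ≡⟨ sum-map-filter (λ j → toℕ j ≤? toℕ i) (f ∘ toℕ) (allFin n) ⟩
  sum (map (g ∘ toℕ) (allFin n))  ≡⟨ sum-map-allFin n g ⟩
  sumBelow g n                  ≡⟨ sumBelow-truncate f g (toℕ<n i) g≡f g≡0 ⟩
  sumBelow f (suc (toℕ i))      ∎
  where
    open ≡-Reasoning
    g : ℕ → ℕ
    g u = indicator (u ≤? toℕ i) (f u)
    g≡f : ∀ u → u ≤ toℕ i → g u ≡ f u
    g≡f u u≤i with u ≤? toℕ i
    ... | yes _   = refl
    ... | no  u≰i = contradiction u≤i u≰i
    g≡0 : ∀ u → toℕ i < u → g u ≡ 0
    g≡0 u i<u with u ≤? toℕ i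
    ... | yes u≤i = contradiction u≤i (<⇒≱ i<u)
    ... | no  _   = refl

-- Greedy filling: x copies spread over consecutive elements, at most ℓ per element.
fill : ℕ → ℕ → ℕ → ℕ
fill ℓ x p = ℓ ⊓ (x ∸ p * ℓ)

fill-≤ : ∀ ℓ x p → fill ℓ x p ≤ ℓ
fill-≤ ℓ x p = m⊓n≤m ℓ _

sumBelow-fill : ∀ ℓ k x → x ≤ k * ℓ → sumBelow (fill ℓ x) k ≡ x
sumBelow-fill ℓ zero    x x≤0 = sym (n≤0⇒n≡0 x≤0)
sumBelow-fill ℓ (suc k) x x≤ = begin
  ℓ ⊓ x + sumBelow (fill ℓ x ∘ suc) k     ≡⟨ cong (ℓ ⊓ x +_) (sumBelow-cong k shift) ⟨
  ℓ ⊓ x + sumBelow (fill ℓ (x ∸ ℓ)) k     ≡⟨ cong (ℓ ⊓ x +_) (sumBelow-fill ℓ k (x ∸ ℓ) rest≤) ⟩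
  ℓ ⊓ x + (x ∸ ℓ)                         ≡⟨ m⊓n+n∸m≡n ℓ x ⟩
  x                                       ∎
  where
    open ≡-Reasoning
    rest≤ : x ∸ ℓ ≤ k * ℓ
    rest≤ = subst (x ∸ ℓ ≤_) (m+n∸m≡n ℓ (k * ℓ)) (∸-monoˡ-≤ ℓ x≤)
    shift : ∀ p → p < k → fill ℓ (x ∸ ℓ) p ≡ fill ℓ x (suc p)
    shift p _ = cong (ℓ ⊓_) (∸-+-assoc x ℓ (p * ℓ))

blocks : ∀ k .{{_ : NonZero k}} → (ℕ → ℕ → ℕ) → ℕ → ℕ
blocks k g u = g (u / k) (u % k)

sumBelow-blocks : ∀ k .{{_ : NonZero k}} (g : ℕ → ℕ → ℕ) t →
  sumBelow (blocks k g) (t * k) ≡ sumBelow (λ j → sumBelow (g j) k) t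
sumBelow-blocks k g zero    = refl
sumBelow-blocks k g (suc t) = begin
  sumBelow (blocks k g) (k + t * k)
    ≡⟨ sumBelow-+ k (t * k) (blocks k g) ⟩
  sumBelow (blocks k g) k + sumBelow (blocks k g ∘ (k +_)) (t * k)
    ≡⟨ cong₂ _+_ (sumBelow-cong k firstBlock) (sumBelow-cong (t * k) (λ u _ → laterBlocks u)) ⟩
  sumBelow (g 0) k + sumBelow (blocks k (g ∘ suc)) (t * k)
    ≡⟨ cong (sumBelow (g 0) k +_) (sumBelow-blocks k (g ∘ suc) t) ⟩
  sumBelow (λ j → sumBelow (g j) k) (suc t)
    ∎
  where
    open ≡-Reasoning
    firstBlock : ∀ u → u < k → blocks k g u ≡ g 0 u
    firstBlock u u<k = cong₂ g (m<n⇒m/n≡0 u<k) (m<n⇒m%n≡m u<k)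
    laterBlocks : ∀ u → blocks k g (k + u) ≡ blocks k (g ∘ suc) u
    laterBlocks u = cong₂ g
      (trans (m/n≡1+[m∸n]/n (m≤m+n k u)) (cong (λ x → suc (x / k)) (m+n∸m≡n k u)))
      (trans (cong (_% k) (+-comm k u)) ([m+n]%n≡m%n u k))

padZero : ∀ {m} → (Fin m → ℕ) → ℕ → ℕ
padZero {zero}  f j       = 0
padZero {suc m} f zero    = f zero
padZero {suc m} f (suc j) = padZero (f ∘ suc) j

padZero-toℕ : ∀ {m} (f : Fin m → ℕ) (j : Fin m) → padZero f (toℕ j) ≡ f j
padZero-toℕ f zero    = refl
padZero-toℕ f (suc j) = padZero-toℕ (f ∘ suc) j

padZero-≤ : ∀ {m} q (f : Fin m → ℕ) → (∀ j → f j ≤ q) → ∀ u → padZero f u ≤ q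
padZero-≤ {zero}  q f f≤q u       = z≤n
padZero-≤ {suc m} q f f≤q zero    = f≤q zero
padZero-≤ {suc m} q f f≤q (suc u) = padZero-≤ q (f ∘ suc) (f≤q ∘ suc) u

m≤⌈m/n⌉*n : ∀ m n .{{_ : NonZero n}} → m ≤ ceilDiv m n * n
m≤⌈m/n⌉*n m n = begin
  m                                         ≤⟨ m≤n+m∸n m 1 ⟩
  suc (m ∸ 1)                               ≡⟨ cong suc (m≡m%n+[m/n]*n (m ∸ 1) n) ⟩
  suc ((m ∸ 1) % n + (m ∸ 1) / n * n)       ≤⟨ +-monoˡ-≤ _ (m%n<n (m ∸ 1) n) ⟩
  ceilDiv m n * n                           ∎
  where open ≤-Reasoning

[m/n⊔1]*n≤⌈n/m⌉*m : ∀ m n .{{_ : NonZero m}} .{{_ : NonZero n}} → (m / n ⊔ 1) * n ≤ ceilDiv n m * m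
[m/n⊔1]*n≤⌈n/m⌉*m m n = begin
  (m / n ⊔ 1) * n        ≡⟨ *-distribʳ-⊔ n (m / n) 1 ⟩
  m / n * n ⊔ 1 * n      ≤⟨ ⊔-mono-≤ (m/n*n≤m m n) (≤-reflexive (*-identityˡ n)) ⟩
  m ⊔ n                  ≤⟨ ⊔-lub (m≤m+n m _) (m≤⌈m/n⌉*n n m) ⟩
  ceilDiv n m * m        ∎
  where open ≤-Reasoning

drankA-window : ∀ {R R′ δ r} → ValidDrankA R δ r → ValidDrankA R′ δ r → R′ < R + δ
drankA-window {R} {R′} {δ} (_ , r≤R) (R′-δ<r , _) =
  Intₚ.drop‿+<+ (subst₂ Int._<_ R′-δ+δ≡R′ (sym (Intₚ.pos-+ R δ)) shifted)
  where
    open Int using (+_) renaming (_+_ to _+ℤ_; _-_ to _-ℤ_; _<_ to _<ℤ_)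
    shifted : (+ R′ -ℤ + δ) +ℤ + δ <ℤ + R +ℤ + δ
    shifted = Intₚ.+-monoˡ-< (+ δ) (Intₚ.<-≤-trans R′-δ<r r≤R)
    R′-δ+δ≡R′ : (+ R′ -ℤ + δ) +ℤ + δ ≡ + R′
    R′-δ+δ≡R′ = trans (Intₚ.+-assoc (+ R′) (Int.- + δ) (+ δ))
                      (trans (cong (+ R′ +ℤ_) (Intₚ.+-inverseˡ (+ δ))) (Intₚ.+-identityʳ _))

drankA-multiple-injective : ∀ {A B δ r} → ValidDrankA (A * δ) δ r → ValidDrankA (B * δ) δ r → A ≡ B
drankA-multiple-injective {A} {B} {δ} validA validB =
  ≤-antisym (factor≤ (drankA-window validB validA)) (factor≤ (drankA-window validA validB))
  where
    factor≤ : ∀ {X Y} → Y * δ < X * δ + δ → Y ≤ X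
    factor≤ {X} {Y} p =
      m<1+n⇒m≤n (*-cancelʳ-< δ Y (suc X) (subst (Y * δ <_) (+-comm (X * δ) δ) p))

funToFin-cong : ∀ {m n} {f g : Fin m → Fin n} → f ≗ g → funToFin f ≡ funToFin g
funToFin-cong {zero}  f≗g = refl
funToFin-cong {suc m} f≗g = cong₂ combine (f≗g zero) (funToFin-cong (f≗g ∘ suc))

finToFun-injective : ∀ {m n} {x y : Fin (n ^ m)} → finToFun {n} {m} x ≗ finToFun y → x ≡ y
finToFun-injective {m} {n} {x} {y} eq =
  trans (sym (funToFin-finToFin {m} {n} x))
        (trans (funToFin-cong {m} {n} eq) (funToFin-finToFin {m} {n} y))

bitsToFin : ∀ {b} → Vec Bool b → Fin (2 ^ b)
bitsToFin v = funToFin (Inverse.from 2↔Bool ∘ lookup v)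

bitsToFin-injective : ∀ {b} → Injective _≡_ _≡_ (bitsToFin {b})
bitsToFin-injective {_} {v} {w} eq = begin
  v                        ≡⟨ tabulate∘lookup v ⟨
  Vec.tabulate (lookup v)  ≡⟨ tabulate-cong sameBit ⟩
  Vec.tabulate (lookup w)  ≡⟨ tabulate∘lookup w ⟩
  w                        ∎
  where
    open ≡-Reasoning
    open Inverse 2↔Bool using (to; from; strictlyInverseˡ)
    sameBit : lookup v ≗ lookup w
    sameBit i = begin
      lookup v i                     ≡⟨ strictlyInverseˡ (lookup v i) ⟨
      to (from (lookup v i))         ≡⟨ cong to (finToFun-funToFin _ i) ⟨
      to (finToFun (bitsToFin v) i)  ≡⟨ cong (λ x → to (finToFun x i)) eq ⟩
      to (finToFun (bitsToFin w) i)  ≡⟨ cong to (finToFun-funToFin _ i) ⟩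
      to (from (lookup w i))         ≡⟨ strictlyInverseˡ (lookup w i) ⟩
      lookup w i                     ∎

module HardInstance (n δ ℓ : ℕ) .{{_ : NonZero δ}} .{{_ : NonZero ℓ}} where

  k q m : ℕ
  k = ceilDiv δ ℓ
  q = ℓ / δ ⊔ 1
  m = n / k

  BlockCounts : Set
  BlockCounts = Fin m → Fin (q + 1)

  count : BlockCounts → ℕ → ℕ
  count c = padZero (toℕ ∘ c)

  count-fits : ∀ c j → count c j * δ ≤ k * ℓ
  count-fits c j =
    ≤-trans (*-monoˡ-≤ δ (padZero-≤ q (toℕ ∘ c) toℕ≤q j)) ([m/n⊔1]*n≤⌈n/m⌉*m ℓ δ)
    where
      toℕ≤q : ∀ j → toℕ (c j) ≤ q
      toℕ≤q j = m<1+n⇒m≤n (subst (toℕ (c j) <_) (+-comm q 1) (toℕ<n (c j)))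

  multiplicity : BlockCounts → ℕ → ℕ
  multiplicity c = blocks k (λ j → fill ℓ (count c j * δ))

  hardInstance : BlockCounts → BoundedMultiset n ℓ
  hardInstance c = multiplicity c ∘ toℕ , λ i → fill-≤ ℓ (count c (toℕ i / k) * δ) (toℕ i % k)

  blockEnd<n : ∀ j → j < m → pred k + j * k < n
  blockEnd<n j j<m = ≤-trans (*-monoˡ-≤ k j<m) (m/n*n≤m n k)

  blockEnd : ∀ j → j < m → Fin n
  blockEnd j j<m = fromℕ< (blockEnd<n j j<m)

  rank-blockEnd : ∀ c j (j<m : j < m) →
    rank (blockEnd j j<m) (proj₁ (hardInstance c)) ≡ sumBelow (count c) (suc j) * δ
  rank-blockEnd c j j<m = begin
    rank (blockEnd j j<m) (proj₁ (hardInstance c))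
      ≡⟨ rank-toℕ (multiplicity c) (blockEnd j j<m) ⟩
    sumBelow (multiplicity c) (suc (toℕ (blockEnd j j<m)))
      ≡⟨ cong (sumBelow (multiplicity c) ∘ suc) (toℕ-fromℕ< (blockEnd<n j j<m)) ⟩
    sumBelow (multiplicity c) (suc j * k)
      ≡⟨ sumBelow-blocks k (λ i → fill ℓ (count c i * δ)) (suc j) ⟩
    sumBelow (λ i → sumBelow (fill ℓ (count c i * δ)) k) (suc j)
      ≡⟨ sumBelow-cong (suc j) (λ i _ → sumBelow-fill ℓ k _ (count-fits c i)) ⟩
    sumBelow (λ i → count c i * δ) (suc j)
      ≡⟨ sumBelow-*ʳ (suc j) (count c) δ ⟩
    sumBelow (count c) (suc j) * δ
      ∎
    where open ≡-Reasoning

  answers-determine-counts : ∀ c c′ (answer : Fin n → ℤ) →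
    (∀ i → ValidDrankA (rank i (proj₁ (hardInstance c))) δ (answer i)) →
    (∀ i → ValidDrankA (rank i (proj₁ (hardInstance c′))) δ (answer i)) → c ≗ c′
  answers-determine-counts c c′ answer valid valid′ j = toℕ-injective (begin
    toℕ (c j)             ≡⟨ padZero-toℕ (toℕ ∘ c) j ⟨
    count c (toℕ j)       ≡⟨ sumBelow-injective m {count c} {count c′} samePrefix (toℕ j) (toℕ<n j) ⟩
    count c′ (toℕ j)      ≡⟨ padZero-toℕ (toℕ ∘ c′) j ⟩
    toℕ (c′ j)            ∎)
    where
      open ≡-Reasoning
      samePrefix : ∀ j → j < m → sumBelow (count c) (suc j) ≡ sumBelow (count c′) (suc j)
      samePrefix j j<m = drankA-multiple-injective
        (subst (λ R → ValidDrankA R δ (answer i)) (rank-blockEnd c j j<m) (valid i))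
        (subst (λ R → ValidDrankA R δ (answer i)) (rank-blockEnd c′ j j<m) (valid′ i))
        where i = blockEnd j j<m

theorem6 : (n δ ℓ : ℕ) → .{{_ : NonZero n}} → .{{_ : NonZero δ}} → .{{_ : NonZero ℓ}} →
    (b : ℕ) (enc : BoundedMultiset n ℓ → Vec Bool b) (query : Vec Bool b → Fin n → ℤ) →
    ((S : BoundedMultiset n ℓ) (i : Fin n) → ValidDrankA (rank i (proj₁ S)) δ (query (enc S) i)) →
    (((ℓ / δ) ⊔ 1) + 1) ^ (n / ceilDiv δ ℓ) ≤ 2 ^ b
theorem6 n δ ℓ b enc query valid = injective⇒≤ code-injective
  where
    open HardInstance n δ ℓ

    S : Fin ((q + 1) ^ m) → BoundedMultiset n ℓ
    S = hardInstance ∘ finToFun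

    code : Fin ((q + 1) ^ m) → Fin (2 ^ b)
    code = bitsToFin ∘ enc ∘ S

    code-injective : Injective _≡_ _≡_ code
    code-injective {x} {y} sameCode =
      finToFun-injective (answers-determine-counts (finToFun x) (finToFun y) answer (valid (S x)) valid′)
      where
        answer : Fin n → ℤ
        answer = query (enc (S x))
        valid′ : ∀ i → ValidDrankA (rank i (proj₁ (S y))) δ (answer i)
        valid′ i = subst (λ bits → ValidDrankA (rank i (proj₁ (S y))) δ (query bits i))
                         (sym (bitsToFin-injective sameCode)) (valid (S y) i)
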